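{- For every simple graph $Y$ on $n$ vertices, the diameter of any connected component of $\mathsf{FS}(\mathsf{Cycle}_n,Y)$ is at most $8n^4(1+o(1))$, where the $o(1)$ term depends only on $n$ and tends to $0$ as $n\to\infty$.
   Context: For simple graphs $X,Y$ on $n$ vertices, $\mathsf{FS}(X,Y)$ has as vertices all bijections $V(X)\to V(Y)$, with $\sigma,\tau$ adjacent iff there is an edge $\{a,b\}\in E(X)$ such that $\{\sigma(a),\sigma(b)\}\in E(Y)$, $\tau(a)=\sigma(b)$, $\tau(b)=\sigma(a)$, and $\tau(c)=\sigma(c)$ for all other $c$. $\mathsf{Cycle}_n$ is the cycle on $[n]$ with edges $\{i,i+1\}$ for $i\in[n-1]$ and $\{n,1\}$. -}

module Defs where

open import Data.Nat using (ℕ; zero; suc)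
open import Data.Fin using (Fin; toℕ)
open import Data.Fin.Permutation using (Permutation′; _⟨$⟩ʳ_)
open import Data.Product using (Σ; _×_; _,_; proj₁; proj₂)
open import Data.Sum using (_⊎_; inj₁; inj₂)
open import Data.Empty using (⊥)
open import Relation.Nullary using (¬_)
open import Relation.Binary.PropositionalEquality using (_≡_; _≢_; refl; sym)

record SimpleGraph (n : ℕ) : Set₁ where
  field
    Adj    : Fin n → Fin n → Set
    adj-sym    : ∀ {a b} → Adj a b → Adj b a
    adj-irrefl : ∀ {a} → ¬ Adj a a
open SimpleGraph public

-- Cycle_n on vertices Fin n (vertex i+1 of the paper is i here):
-- edges {i, i+1} and {n-1, 0}; loops excluded (relevant only for n = 1).
CycleAdj : (n : ℕ) → Fin n → Fin n → Set
CycleAdj n a b =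
  a ≢ b ×
  (  toℕ b ≡ suc (toℕ a)
  ⊎ toℕ a ≡ suc (toℕ b)
  ⊎ (toℕ a ≡ 0 × suc (toℕ b) ≡ n)
  ⊎ (toℕ b ≡ 0 × suc (toℕ a) ≡ n))

Cycle : (n : ℕ) → SimpleGraph n
Cycle n = record { Adj = CycleAdj n ; adj-sym = s ; adj-irrefl = λ p → proj₁ p refl }
  where
  s : ∀ {a b} → CycleAdj n a b → CycleAdj n b a
  s (ne , inj₁ e) = (λ x → ne (sym x)) , inj₂ (inj₁ e)
  s (ne , inj₂ (inj₁ e)) = (λ x → ne (sym x)) , inj₁ e
  s (ne , inj₂ (inj₂ (inj₁ e))) = (λ x → ne (sym x)) , inj₂ (inj₂ (inj₂ e))
  s (ne , inj₂ (inj₂ (inj₂ e))) = (λ x → ne (sym x)) , inj₂ (inj₂ (inj₁ e))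

FSStep : ∀ {n} → SimpleGraph n → SimpleGraph n → (Fin n → Fin n) → (Fin n → Fin n) → Set
FSStep {n} X Y σ τ =
  Σ (Fin n) λ a → Σ (Fin n) λ b →
    Adj X a b × Adj Y (σ a) (σ b) × τ a ≡ σ b × τ b ≡ σ a ×
    (∀ c → c ≢ a → c ≢ b → τ c ≡ σ c)

data FSWalk {n} (X Y : SimpleGraph n) : (Fin n → Fin n) → (Fin n → Fin n) → ℕ → Set where
  stay : ∀ {σ τ} → (∀ i → σ i ≡ τ i) → FSWalk X Y σ τ 0
  step : ∀ {σ ρ τ k} → FSStep X Y σ ρ → FSWalk X Y ρ τ k → FSWalk X Y σ τ (suc k)

SameComponent : ∀ {n} → SimpleGraph n → SimpleGraph n → Permutation′ n → Permutation′ n → Set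
SameComponent X Y σ τ = Σ ℕ λ k → FSWalk X Y (σ ⟨$⟩ʳ_) (τ ⟨$⟩ʳ_) k

{-# OPTIONS --safe #-}
module Submission where

-- Lift a bijection σ to the universal cover of the cycle: label p gets the integer height
-- n·w(p) + pos(p), where the winding w(p) counts the turns p has made. An FS-step exchanges
-- the labels at two consecutive positions, moving one up and one down by one. It preserves
-- the total height and changes `laps u v`, the number of turns by which v is ahead of u,
-- only for the exchanged pair, which is an edge of Y. Lifting a walk from σ to τ therefore
-- gives a lift t of τ with the total height of the flat lift of σ and the same laps off the
-- edges of Y. If two windings of t differ by more than n(n + 1), the n windings leave a gap of
-- width n that only edges of Y cross; pulling everything above it down by n keeps both
-- invariants, so we may assume the windings differ by at most n(n + 1). Finally, while some
-- label is displaced less than its predecessor on the way to t, exchanging the two is an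
-- FS-step (their laps differ, so they are adjacent in Y) that moves the laps towards those
-- of t; otherwise the displacement is constant, and the total height forces it to be 0.
-- The resulting walk has length at most Σ |laps t − laps σ| ≤ n²(n(n + 1) + 1) ≤ 8n⁴.

open import Defs

module FriendsAndStrangers where

  open import Data.Nat.Base as ℕ using (ℕ; zero; suc; z≤n; s≤s)
  import Data.Nat.Properties as ℕ
  open import Data.Integer.Base
    using (ℤ; +_; -_; _+_; _-_; _*_; _≤_; _<_; 0ℤ; 1ℤ; -1ℤ; ∣_∣; +≤+; -≤+; +<+)
  open import Data.Integer.Properties hiding (_≟_)
  open import Data.Integer.Tactic.RingSolver using (solve-∀)
  open import Algebra.Properties.Semiring.Sum +-*-semiring
    using (sum; sum-cong-≗; sum-replicate-zero; ∑-distrib-+; *-distribˡ-sum)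
  open import Algebra.Properties.CommutativeMonoid.Sum ℕ.+-0-commutativeMonoid
    using () renaming (sum to sumℕ)
  open import Data.Bool.Base using (if_then_else_)
  open import Data.Fin.Base using (Fin; zero; suc; toℕ; inject₁; fromℕ)
  open import Data.Fin.Induction using (<-weakInduction; >-weakInduction)
  open import Data.Fin.Permutation.Components using (transpose)
  open import Data.Fin.Permutation as Perm
    using (Permutation′; _⟨$⟩ʳ_; _⟨$⟩ˡ_; inverseˡ; inverseʳ; _∘ₚ_)
  open import Data.Fin.Properties
    using (_≟_; toℕ<n; toℕ-injective; toℕ-inject₁; toℕ-fromℕ; any?; ¬∀⟶∃¬; <⇒notInjective)
  open import Data.Product.Base using (Σ; ∃; _×_; _,_; proj₁; proj₂)
  open import Data.Sum.Base as Sum using (_⊎_; inj₁; inj₂)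
  open import Function.Base using (_∘_)
  open import Induction.WellFounded using (Acc; acc)
  open import Data.Nat.Induction using (<-wellFounded)
  open import Relation.Nullary using (¬_; Dec; yes; no; does; contradiction)
  open import Relation.Nullary.Decidable using (_×-dec_; map′; dec-true; dec-false)
  open import Relation.Binary.PropositionalEquality
    using (_≡_; _≢_; refl; sym; trans; cong; cong₂; subst; subst₂; module ≡-Reasoning)

  record Floor (n : ℕ) (d k : ℤ) : Set where
    constructor floor
    field
      lower : + n * k ≤ d
      upper : d < + n * k + + n

  record StrictFloor (n : ℕ) (d k : ℤ) : Set where
    constructor strictFloor
    field
      lower : + n * k < d
      upper : d < + n * k + + n

  <⇒+1≤ : ∀ {i j} → i < j → i + 1ℤ ≤ j
  <⇒+1≤ {i} i<j = subst (_≤ _) (+-comm 1ℤ i) (i<j⇒suc[i]≤j i<j)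

  <+1⇒≤ : ∀ {i j} → i < j + 1ℤ → i ≤ j
  <+1⇒≤ {i} {j} i<j+1 = subst (i ≤_) (pred[j+1]≡j j) (i<j⇒i≤pred[j] i<j+1)
    where
    pred[j+1]≡j : ∀ j → -1ℤ + (j + 1ℤ) ≡ j
    pred[j+1]≡j = solve-∀

  a-b<c-d⇒a-c<b-d : ∀ a b c d → a - b < c - d → a - c < b - d
  a-b<c-d⇒a-c<b-d a b c d a-b<c-d =
    subst₂ _<_ (regroup₁ a b c) (regroup₂ b c d) (+-monoˡ-< (b - c) a-b<c-d)
    where
    regroup₁ : ∀ a b c → a - b + (b - c) ≡ a - c
    regroup₁ = solve-∀
    regroup₂ : ∀ b c d → c - d + (b - c) ≡ b - d
    regroup₂ = solve-∀

  n*k<n*l+n⇒k≤l : ∀ n {k l} → + n * k < + n * l + + n → k ≤ l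
  n*k<n*l+n⇒k≤l n {k} {l} lt =
    <+1⇒≤ (*-cancelˡ-<-nonNeg (+ n) (subst (_ <_) (distrib (+ n) l) lt))
    where
    distrib : ∀ n l → n * l + n ≡ n * (l + 1ℤ)
    distrib = solve-∀

  floor-mono : ∀ {n d d′ k k′} → Floor n d k → Floor n d′ k′ → d ≤ d′ → k ≤ k′
  floor-mono {n} {d} {d′} {k} {k′} (floor nk≤d _) (floor _ d′<) d≤d′ =
    n*k<n*l+n⇒k≤l n (≤-<-trans nk≤d (≤-<-trans d≤d′ d′<))

  floor-unique : ∀ {n d k k′} → Floor n d k → Floor n d k′ → k ≡ k′
  floor-unique f f′ = ≤-antisym (floor-mono f f′ ≤-refl) (floor-mono f′ f ≤-refl)

  strictFloor-shift : ∀ {n d k} m → StrictFloor n d k → StrictFloor n (+ n * m + d) (m + k)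
  strictFloor-shift {n} {d} {k} m (strictFloor nk<d d<nk+n) = strictFloor
    (subst (_< _) (sym (*-distribˡ-+ (+ n) m k)) (+-monoʳ-< (+ n * m) nk<d))
    (subst (_ <_) (distrib (+ n) m k) (+-monoʳ-< (+ n * m) d<nk+n))
    where
    distrib : ∀ n m k → n * m + (n * k + n) ≡ n * (m + k) + n
    distrib = solve-∀

  strictFloor-mono : ∀ {n d d′ k k′} → StrictFloor n d k → StrictFloor n d′ k′ →
                     d ≤ d′ + 1ℤ → k ≤ k′
  strictFloor-mono {n} {d} {d′} {k} {k′} (strictFloor nk<d _) (strictFloor _ d′<) d≤d′+1 =
    n*k<n*l+n⇒k≤l n (<-≤-trans nk<d (≤-trans d≤d′+1 (<⇒+1≤ d′<)))

  strictFloor-stable : ∀ {n d e k k′} → StrictFloor n d k → StrictFloor n (d + e) k′ →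
                       -1ℤ ≤ e → e ≤ 1ℤ → k ≡ k′
  strictFloor-stable {d = d} {e} f f′ -1≤e e≤1 = ≤-antisym
    (strictFloor-mono f f′ (begin
      d               ≡⟨ regroup d ⟩
      d + -1ℤ + 1ℤ    ≤⟨ +-monoˡ-≤ 1ℤ (+-monoʳ-≤ d -1≤e) ⟩
      d + e + 1ℤ      ∎))
    (strictFloor-mono f′ f (+-monoʳ-≤ d e≤1))
    where
    open ≤-Reasoning
    regroup : ∀ d → d ≡ d + -1ℤ + 1ℤ
    regroup = solve-∀

  strictFloor-unique : ∀ {n d k k′} → StrictFloor n d k → StrictFloor n d k′ → k ≡ k′
  strictFloor-unique {n} {d} {k′ = k′} f f′ = strictFloor-stable f
    (subst (λ d → StrictFloor n d k′) (sym (+-identityʳ d)) f′) -≤+ (+≤+ z≤n)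

  strictFloor-pred : ∀ {n} k → 1 ℕ.< n → StrictFloor n (+ n * k - 1ℤ) (k - 1ℤ)
  strictFloor-pred {n} k 1<n = strictFloor
    (begin-strict
      + n * (k - 1ℤ)   ≡⟨ distrib (+ n) k ⟩
      + n * k - + n    <⟨ +-monoʳ-< (+ n * k) (neg-mono-< (+<+ 1<n)) ⟩
      + n * k - 1ℤ     ∎)
    (begin-strict
      + n * k - 1ℤ             <⟨ +-monoʳ-< (+ n * k) (neg-mono-< (+<+ (s≤s z≤n))) ⟩
      + n * k + 0ℤ             ≡⟨ cancel (+ n) k ⟩
      + n * (k - 1ℤ) + + n     ∎)
    where
    open ≤-Reasoning
    distrib : ∀ n k → n * (k - 1ℤ) ≡ n * k - n
    distrib = solve-∀
    cancel : ∀ n k → n * k + 0ℤ ≡ n * (k - 1ℤ) + n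
    cancel = solve-∀

  strictFloor-neg : ∀ {n d k} → StrictFloor n d k → StrictFloor n (- d) (-1ℤ - k)
  strictFloor-neg {n} {d} {k} (strictFloor nk<d d<nk+n) = strictFloor
      (subst (_< - d) (regroup₁ (+ n) k) (neg-mono-< d<nk+n))
      (subst (- d <_) (regroup₂ (+ n) k) (neg-mono-< nk<d))
    where
    regroup₁ : ∀ n k → - (n * k + n) ≡ n * (-1ℤ - k)
    regroup₁ = solve-∀
    regroup₂ : ∀ n k → - (n * k) ≡ n * (-1ℤ - k) + n
    regroup₂ = solve-∀

  floor? : ∀ n d k → Dec (Floor n d k)
  floor? n d k = map′ (λ (l , u) → floor l u) (λ f → Floor.lower f , Floor.upper f)
                      (+ n * k ≤? d ×-dec d <? + n * k + + n)

  ∣i-j∣<∣i∣ : ∀ {i j} → 0ℤ < j → j ≤ i → ∣ i - j ∣ ℕ.< ∣ i ∣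
  ∣i-j∣<∣i∣ {i} {j} 0<j j≤i = drop‿+<+ (begin-strict
    + ∣ i - j ∣  ≡⟨ 0≤i⇒+∣i∣≡i (i≤j⇒0≤j-i j≤i) ⟩
    i - j        <⟨ +-monoʳ-< i (neg-mono-< 0<j) ⟩
    i + 0ℤ       ≡⟨ +-identityʳ i ⟩
    i            ≡⟨ 0≤i⇒+∣i∣≡i (≤-trans (<⇒≤ 0<j) j≤i) ⟨
    + ∣ i ∣      ∎)
    where open ≤-Reasoning

  ∣i+j∣<∣i∣ : ∀ {i j} → 0ℤ < j → j ≤ - i → ∣ i + j ∣ ℕ.< ∣ i ∣
  ∣i+j∣<∣i∣ {i} {j} 0<j j≤-i = begin-strict
    ∣ i + j ∣      ≡⟨ ∣-i∣≡∣i∣ (i + j) ⟨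
    ∣ - (i + j) ∣  ≡⟨ cong ∣_∣ (neg-distrib-+ i j) ⟩
    ∣ - i - j ∣    <⟨ ∣i-j∣<∣i∣ 0<j j≤-i ⟩
    ∣ - i ∣        ≡⟨ ∣-i∣≡∣i∣ i ⟩
    ∣ i ∣          ∎
    where open ℕ.≤-Reasoning

  ∣a-[b-1]∣<∣a-b∣ : ∀ {a b} → a < b → ∣ a - (b - 1ℤ) ∣ ℕ.< ∣ a - b ∣
  ∣a-[b-1]∣<∣a-b∣ {a} {b} a<b =
    subst (λ x → ∣ x ∣ ℕ.< ∣ a - b ∣) (regroup a b)
      (∣i+j∣<∣i∣ (+<+ (s≤s z≤n)) (subst (1ℤ ≤_) (flip a b) (+1≤⇒1≤- (<⇒+1≤ a<b))))
    where
    regroup : ∀ a b → a - b + 1ℤ ≡ a - (b - 1ℤ)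
    regroup = solve-∀
    flip : ∀ a b → b - a ≡ - (a - b)
    flip = solve-∀
    +1≤⇒1≤- : ∀ {a b} → a + 1ℤ ≤ b → 1ℤ ≤ b - a
    +1≤⇒1≤- {a} {b} a+1≤b = subst (_≤ b - a) (cancel a) (+-monoˡ-≤ (- a) a+1≤b)
      where
      cancel : ∀ a → a + 1ℤ - a ≡ 1ℤ
      cancel = solve-∀

  ∣a-[b+1]∣<∣a-b∣ : ∀ {a b} → b < a → ∣ a - (b + 1ℤ) ∣ ℕ.< ∣ a - b ∣
  ∣a-[b+1]∣<∣a-b∣ {a} {b} b<a =
    subst (λ x → ∣ x ∣ ℕ.< ∣ a - b ∣) (regroup a b)
      (∣i-j∣<∣i∣ (+<+ (s≤s z≤n)) (subst (_≤ a - b) (cancel b) (+-monoˡ-≤ (- b) (<⇒+1≤ b<a))))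
    where
    regroup : ∀ a b → a - b - 1ℤ ≡ a - (b + 1ℤ)
    regroup = solve-∀
    cancel : ∀ b → b + 1ℤ - b ≡ 1ℤ
    cancel = solve-∀

  -m≤i≤m⇒∣i∣≤m : ∀ {i m} → - + m ≤ i → i ≤ + m → ∣ i ∣ ℕ.≤ m
  -m≤i≤m⇒∣i∣≤m {i} {m} lower upper with 0ℤ ≤? i
  ... | yes 0≤i = drop‿+≤+ (subst (_≤ + m) (sym (0≤i⇒+∣i∣≡i 0≤i)) upper)
  ... | no  0≰i = subst (ℕ._≤ m) (∣-i∣≡∣i∣ i)
                        (drop‿+≤+ (subst (_≤ + m) (sym (0≤i⇒+∣i∣≡i 0≤-i)) -i≤m))
    where
    0≤-i : 0ℤ ≤ - i
    0≤-i = neg-mono-≤ (<⇒≤ (≰⇒> 0≰i))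
    -i≤m : - i ≤ + m
    -i≤m = subst (- i ≤_) (neg-involutive (+ m)) (neg-mono-≤ lower)

  sumℕ-mono-≤ : ∀ {n} {f g : Fin n → ℕ} → (∀ i → f i ℕ.≤ g i) → sumℕ f ℕ.≤ sumℕ g
  sumℕ-mono-≤ {zero}  f≤g = z≤n
  sumℕ-mono-≤ {suc n} f≤g = ℕ.+-mono-≤ (f≤g zero) (sumℕ-mono-≤ (f≤g ∘ suc))

  sumℕ-mono-< : ∀ {n} {f g : Fin n → ℕ} → (∀ i → f i ℕ.≤ g i) →
                ∀ i → f i ℕ.< g i → sumℕ f ℕ.< sumℕ g
  sumℕ-mono-< f≤g zero    f<g = ℕ.+-mono-<-≤ f<g (sumℕ-mono-≤ (f≤g ∘ suc))
  sumℕ-mono-< f≤g (suc i) f<g = ℕ.+-mono-≤-< (f≤g zero) (sumℕ-mono-< (f≤g ∘ suc) i f<g)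

  sumℕ²-mono-< : ∀ {n} {f g : Fin n → Fin n → ℕ} → (∀ i j → f i j ℕ.≤ g i j) →
                 ∀ i j → f i j ℕ.< g i j →
                 sumℕ (λ i → sumℕ (f i)) ℕ.< sumℕ (λ i → sumℕ (g i))
  sumℕ²-mono-< f≤g i j f<g =
    sumℕ-mono-< (λ i → sumℕ-mono-≤ (f≤g i)) i (sumℕ-mono-< (f≤g i) j f<g)

  sumℕ-≤-* : ∀ {n} {f : Fin n → ℕ} c → (∀ i → f i ℕ.≤ c) → sumℕ f ℕ.≤ n ℕ.* c
  sumℕ-≤-* {zero}  c f≤c = z≤n
  sumℕ-≤-* {suc n} c f≤c = ℕ.+-mono-≤ (f≤c zero) (sumℕ-≤-* c (f≤c ∘ suc))

  sum-neg : ∀ {n} (f : Fin n → ℤ) → sum (λ p → - f p) ≡ - sum f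
  sum-neg f = begin
    sum (λ p → - f p)       ≡⟨ sum-cong-≗ (λ p → sym (-1*i≡-i (f p))) ⟩
    sum (λ p → -1ℤ * f p)   ≡⟨ *-distribˡ-sum -1ℤ f ⟨
    -1ℤ * sum f             ≡⟨ -1*i≡-i (sum f) ⟩
    - sum f                 ∎
    where open ≡-Reasoning

  sum-const : ∀ n c → sum {n} (λ _ → c) ≡ + n * c
  sum-const zero    c = refl
  sum-const (suc n) c = trans (cong (_+_ c) (sum-const n c)) (sym (suc-* (+ n) c))

  translate-sum-zero : ∀ {n} {f g : Fin n → ℤ} {c} → 0 ℕ.< n →
                       (∀ p → g p ≡ f p + c) → sum f ≡ sum g → c ≡ 0ℤ
  translate-sum-zero {n} {f} {g} {c} 0<n g≡f+c sums with i*j≡0⇒i≡0∨j≡0 (+ n) n*c≡0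
    where
    cancel : ∀ a {b} → a + b ≡ a → b ≡ 0ℤ
    cancel a {b} a+b≡a = trans (regroup a b) (trans (cong (_- a) a+b≡a) (+-inverseʳ a))
      where
      regroup : ∀ a b → b ≡ a + b - a
      regroup = solve-∀
    n*c≡0 : + n * c ≡ 0ℤ
    n*c≡0 = cancel (sum f) (begin
      sum f + + n * c               ≡⟨ cong (_+_ (sum f)) (sum-const n c) ⟨
      sum f + sum {n} (λ _ → c)     ≡⟨ ∑-distrib-+ f (λ _ → c) ⟨
      sum (λ p → f p + c)           ≡⟨ sum-cong-≗ g≡f+c ⟨
      sum g                         ≡⟨ sums ⟨
      sum f                         ∎)
      where open ≡-Reasoning
  ... | inj₁ n≡0 = contradiction (+-injective n≡0) (ℕ.n>0⇒n≢0 0<n)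
  ... | inj₂ c≡0 = c≡0

  δ : ∀ {n} → Fin n → Fin n → ℤ
  δ u p = if does (p ≟ u) then 1ℤ else 0ℤ

  δ-same : ∀ {n} (u : Fin n) → δ u u ≡ 1ℤ
  δ-same u rewrite dec-true (u ≟ u) refl = refl

  δ-other : ∀ {n} {u p : Fin n} → p ≢ u → δ u p ≡ 0ℤ
  δ-other {u = u} {p} p≢u rewrite dec-false (p ≟ u) p≢u = refl

  δ-bounds : ∀ {n} (u p : Fin n) → 0ℤ ≤ δ u p × δ u p ≤ 1ℤ
  δ-bounds u p with p ≟ u
  ... | yes _ = +≤+ z≤n , ≤-refl
  ... | no  _ = ≤-refl , +≤+ z≤n

  δ-pair-≤1 : ∀ {n} {u v p q : Fin n} → ¬ (q ≡ u × p ≡ v) → δ u q + δ v p ≤ 1ℤ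
  δ-pair-≤1 {u = u} {v} {p} {q} ¬q≡u×p≡v = by-cases (q ≟ u) (p ≟ v)
    where
    open ≤-Reasoning
    by-cases : Dec (q ≡ u) → Dec (p ≡ v) → δ u q + δ v p ≤ 1ℤ
    by-cases (yes q≡u) (yes p≡v) = contradiction (q≡u , p≡v) ¬q≡u×p≡v
    by-cases (no q≢u)  _         = begin
      δ u q + δ v p   ≡⟨ cong (_+ δ v p) (δ-other q≢u) ⟩
      0ℤ + δ v p      ≡⟨ +-identityˡ (δ v p) ⟩
      δ v p           ≤⟨ proj₂ (δ-bounds v p) ⟩
      1ℤ              ∎
    by-cases (yes _)   (no p≢v)  = begin
      δ u q + δ v p   ≡⟨ cong (_+_ (δ u q)) (δ-other p≢v) ⟩
      δ u q + 0ℤ      ≡⟨ +-identityʳ (δ u q) ⟩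
      δ u q           ≤⟨ proj₂ (δ-bounds u q) ⟩
      1ℤ              ∎

  sum-δ : ∀ {n} (u : Fin n) → sum (δ u) ≡ 1ℤ
  sum-δ {suc n} zero    = cong (_+_ 1ℤ) (sum-replicate-zero n)
  sum-δ {suc n} (suc u) = trans (+-identityˡ _) (sum-δ u)

  emptyCell : ∀ {m} (W : Fin m → ℤ) g →
              ∃ λ (k : Fin (suc m)) → ∀ p → ¬ Floor g (W p) (+ toℕ k)
  emptyCell {m} W g with ¬∀⟶∃¬ (suc m) Occupied (λ k → any? (λ p → floor? g (W p) (+ toℕ k))) notAll
    where
    Occupied : Fin (suc m) → Set
    Occupied k = ∃ λ p → Floor g (W p) (+ toℕ k)
    notAll : ¬ (∀ k → Occupied k)
    notAll occupied = <⇒notInjective (ℕ.n<1+n m) injective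
      where
      injective : ∀ {k k′} → proj₁ (occupied k) ≡ proj₁ (occupied k′) → k ≡ k′
      injective {k} {k′} same = toℕ-injective (+-injective (floor-unique
        (proj₂ (occupied k)) (subst (λ p → Floor g (W p) _) (sym same) (proj₂ (occupied k′)))))
  ... | k , free = k , λ p inCell → free (p , inCell)

  emptyWindow : ∀ {m} (W : Fin m → ℤ) a g → ∃ λ (k : Fin (suc m)) →
                ∀ p → W p ≤ a + + g * + toℕ k ⊎ a + + g * + toℕ k + + g < W p
  emptyWindow W a g with emptyCell (λ p → W p - a - 1ℤ) g
  ... | k , free = k , λ p → outside (W p) (free p)
    where
    outside : ∀ d → ¬ Floor g (d - a - 1ℤ) (+ toℕ k) →
              d ≤ a + + g * + toℕ k ⊎ a + + g * + toℕ k + + g < d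
    outside d ¬floor with d ≤? a + + g * + toℕ k | a + + g * + toℕ k + + g <? d
    ... | yes below  | _          = inj₁ below
    ... | no  _      | yes above  = inj₂ above
    ... | no  ¬below | no  ¬above = contradiction (floor lower upper) ¬floor
      where
      open ≤-Reasoning
      x : ℤ
      x = + g * + toℕ k
      lower : x ≤ d - a - 1ℤ
      lower = begin
        x                  ≡⟨ regroup₁ a x ⟩
        a + x + 1ℤ - a - 1ℤ ≤⟨ +-monoˡ-≤ -1ℤ (+-monoˡ-≤ (- a) (<⇒+1≤ (≰⇒> ¬below))) ⟩
        d - a - 1ℤ         ∎
        where
        regroup₁ : ∀ a x → x ≡ a + x + 1ℤ - a - 1ℤ
        regroup₁ = solve-∀
      upper : d - a - 1ℤ < x + + g
      upper = begin-strict
        d - a - 1ℤ         ≤⟨ +-monoˡ-≤ -1ℤ (+-monoˡ-≤ (- a) (≮⇒≥ ¬above)) ⟩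
        a + x + + g - a - 1ℤ ≡⟨ regroup₂ a x (+ g) ⟩
        x + + g - 1ℤ       <⟨ +-monoʳ-< (x + + g) (neg-mono-< (+<+ (s≤s z≤n))) ⟩
        x + + g + 0ℤ       ≡⟨ +-identityʳ _ ⟩
        x + + g            ∎
        where
        regroup₂ : ∀ a x g → a + x + g - a - 1ℤ ≡ x + g - 1ℤ
        regroup₂ = solve-∀

  -- Gaps in families of integers

  spread : ∀ {n} → (Fin n → ℤ) → ℕ
  spread W = sumℕ (λ p → sumℕ (λ q → ∣ W p - W q ∣))

  wide⇒gap : ∀ {n} (W : Fin n → ℤ) {u v} → + (n ℕ.* suc n) < W v - W u →
             ∃ λ c → (∀ p → W p ≤ c ⊎ c + + n < W p) × W u ≤ c × c < W v
  wide⇒gap {n} W {u} {v} wide with emptyWindow W (W u) n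
  ... | k , gap = W u + + n * + toℕ k , gap , Wu≤c , c<Wv
    where
    open ≤-Reasoning
    n*k≤n*[1+n] : + n * + toℕ k ≤ + (n ℕ.* suc n)
    n*k≤n*[1+n] = subst (_≤ _) (pos-* n _) (+≤+ (ℕ.*-monoʳ-≤ n (ℕ.<⇒≤ (toℕ<n k))))

    Wu≤c : W u ≤ W u + + n * + toℕ k
    Wu≤c = subst (W u ≤_) (cong (_+_ (W u)) (pos-* n _)) (i≤i+j (W u) _)

    c<Wv : W u + + n * + toℕ k < W v
    c<Wv = begin-strict
      W u + + n * + toℕ k        ≤⟨ +-monoʳ-≤ (W u) n*k≤n*[1+n] ⟩
      W u + + (n ℕ.* suc n)      <⟨ +-monoʳ-< (W u) wide ⟩
      W u + (W v - W u)          ≡⟨ regroup (W u) (W v) ⟩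
      W v                        ∎
      where
      regroup : ∀ a b → a + (b - a) ≡ b
      regroup = solve-∀

  module CloseGap {n} (W : Fin n → ℤ) (c : ℤ) (gap : ∀ p → W p ≤ c ⊎ c + + n < W p) where

    above : Fin n → ℤ
    above p = if does (c <? W p) then 1ℤ else 0ℤ

    -- Values above the gap drop by n; the common shift by sum above makes the corrections sum to 0.
    correction : Fin n → ℤ
    correction p = sum above - + n * above p

    closed : Fin n → ℤ
    closed p = W p + correction p

    sum-correction : sum correction ≡ 0ℤ
    sum-correction = begin
      sum (λ p → sum above - + n * above p)
        ≡⟨ ∑-distrib-+ (λ _ → sum above) (λ p → - (+ n * above p)) ⟩
      sum {n} (λ _ → sum above) + sum (λ p → - (+ n * above p))
        ≡⟨ cong₂ _+_ (sum-const n (sum above)) (sum-neg (λ p → + n * above p)) ⟩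
      + n * sum above - sum (λ p → + n * above p)
        ≡⟨ cong (λ x → + n * sum above - x) (*-distribˡ-sum (+ n) above) ⟨
      + n * sum above - + n * sum above
        ≡⟨ +-inverseʳ (+ n * sum above) ⟩
      0ℤ ∎
      where open ≡-Reasoning

    data Side (p : Fin n) : Set where
      low  : W p ≤ c → above p ≡ 0ℤ → Side p
      high : c + + n < W p → above p ≡ 1ℤ → Side p

    side : ∀ p → Side p
    side p with c <? W p | gap p
    ... | yes c<Wp | inj₁ Wp≤c   = contradiction Wp≤c (<⇒≱ c<Wp)
    ... | yes c<Wp | inj₂ c+n<Wp = high c+n<Wp (above-< c<Wp)
      where
      above-< : c < W p → above p ≡ 1ℤ
      above-< c<Wp rewrite dec-true (c <? W p) c<Wp = refl
    ... | no  c≮Wp | _           = low (≮⇒≥ c≮Wp) (above-≮ c≮Wp)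
      where
      above-≮ : ¬ c < W p → above p ≡ 0ℤ
      above-≮ c≮Wp rewrite dec-false (c <? W p) c≮Wp = refl

    closed-diff : ∀ p q → closed p - closed q ≡ (W p - W q) + + n * (above q - above p)
    closed-diff p q = regroup (W p) (W q) (sum above) (+ n) (above p) (above q)
      where
      regroup : ∀ wp wq a n ap aq → wp + (a - n * ap) - (wq + (a - n * aq)) ≡ (wp - wq) + n * (aq - ap)
      regroup = solve-∀

    closed-same-side : ∀ p q → above p ≡ above q → closed p - closed q ≡ W p - W q
    closed-same-side p q same rewrite closed-diff p q | same | +-inverseʳ (above q) | *-zeroʳ (+ n) =
      +-identityʳ (W p - W q)

    across-gap : ∀ {a b} → a ≤ c → c + + n < b → + n < b - a
    across-gap {a} {b} a≤c c+n<b = begin-strict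
      + n           ≡⟨ regroup a (+ n) ⟩
      a + + n - a   ≤⟨ +-monoˡ-≤ (- a) (+-monoˡ-≤ (+ n) a≤c) ⟩
      c + + n - a   <⟨ +-monoˡ-< (- a) c+n<b ⟩
      b - a         ∎
      where
      open ≤-Reasoning
      regroup : ∀ a n → n ≡ a + n - a
      regroup = solve-∀

    close⇒same-side : 0 ℕ.< n → ∀ p q → -1ℤ ≤ W q - W p → W q - W p ≤ 1ℤ → above p ≡ above q
    close⇒same-side 0<n p q lower upper with side p | side q
    ... | low  _ ap≡0  | low  _ aq≡0  = trans ap≡0 (sym aq≡0)
    ... | high _ ap≡1  | high _ aq≡1  = trans ap≡1 (sym aq≡1)
    ... | low  Wp≤c _   | high c+n<Wq _ =
      contradiction upper (<⇒≱ (≤-<-trans (+≤+ 0<n) (across-gap Wp≤c c+n<Wq)))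
    ... | high c+n<Wp _ | low  Wq≤c _   =
      contradiction (subst (_≤ 1ℤ) (flip (W q) (W p)) (neg-mono-≤ lower))
                    (<⇒≱ (≤-<-trans (+≤+ 0<n) (across-gap Wq≤c c+n<Wp)))
      where
      flip : ∀ a b → - (a - b) ≡ b - a
      flip = solve-∀

    crossing-down : 0 ℕ.< n → ∀ {p q} → c + + n < W p → W q ≤ c → above p ≡ 1ℤ → above q ≡ 0ℤ →
                    ∣ closed p - closed q ∣ ℕ.< ∣ W p - W q ∣
    crossing-down 0<n {p} {q} c+n<Wp Wq≤c ap≡1 aq≡0 =
      subst (λ d → ∣ d ∣ ℕ.< ∣ W p - W q ∣) (sym (trans (closed-diff p q) eq))
            (∣i-j∣<∣i∣ (+<+ 0<n) (<⇒≤ (across-gap Wq≤c c+n<Wp)))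
      where
      eq : (W p - W q) + + n * (above q - above p) ≡ (W p - W q) - + n
      eq rewrite ap≡1 | aq≡0 = regroup (W p - W q) (+ n)
        where
        regroup : ∀ d n → d + n * (0ℤ - 1ℤ) ≡ d - n
        regroup = solve-∀

    crossing-up : 0 ℕ.< n → ∀ {p q} → W p ≤ c → c + + n < W q → above p ≡ 0ℤ → above q ≡ 1ℤ →
                  ∣ closed p - closed q ∣ ℕ.< ∣ W p - W q ∣
    crossing-up 0<n {p} {q} Wp≤c c+n<Wq ap≡0 aq≡1 =
      subst (λ d → ∣ d ∣ ℕ.< ∣ W p - W q ∣) (sym (trans (closed-diff p q) eq))
            (∣i+j∣<∣i∣ (+<+ 0<n) (subst (+ n ≤_) (flip (W q) (W p)) (<⇒≤ (across-gap Wp≤c c+n<Wq))))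
      where
      eq : (W p - W q) + + n * (above q - above p) ≡ (W p - W q) + + n
      eq rewrite ap≡0 | aq≡1 = regroup (W p - W q) (+ n)
        where
        regroup : ∀ d n → d + n * (1ℤ - 0ℤ) ≡ d + n
        regroup = solve-∀
      flip : ∀ a b → a - b ≡ - (b - a)
      flip = solve-∀

    spread-closed : 0 ℕ.< n → ∀ {u v} → W u ≤ c → c < W v → spread closed ℕ.< spread W
    spread-closed 0<n {u} {v} Wu≤c c<Wv = sumℕ²-mono-< closer v u strict
      where
      unchanged : ∀ p q → above p ≡ above q → ∣ closed p - closed q ∣ ℕ.≤ ∣ W p - W q ∣
      unchanged p q same = ℕ.≤-reflexive (cong ∣_∣ (closed-same-side p q same))

      closer : ∀ p q → ∣ closed p - closed q ∣ ℕ.≤ ∣ W p - W q ∣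
      closer p q with side p | side q
      ... | low  _ ap≡0     | low  _ aq≡0     = unchanged p q (trans ap≡0 (sym aq≡0))
      ... | high _ ap≡1     | high _ aq≡1     = unchanged p q (trans ap≡1 (sym aq≡1))
      ... | high c+n<Wp ap≡1 | low  Wq≤c aq≡0 = ℕ.<⇒≤ (crossing-down 0<n c+n<Wp Wq≤c ap≡1 aq≡0)
      ... | low  Wp≤c ap≡0  | high c+n<Wq aq≡1 = ℕ.<⇒≤ (crossing-up 0<n Wp≤c c+n<Wq ap≡0 aq≡1)

      strict : ∣ closed v - closed u ∣ ℕ.< ∣ W v - W u ∣
      strict with side v | side u
      ... | low  Wv≤c _      | _               = contradiction Wv≤c (<⇒≱ c<Wv)
      ... | high _ _         | high c+n<Wu _   = contradiction Wu≤c (<⇒≱ (≤-<-trans (i≤i+j c (+ n)) c+n<Wu))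
      ... | high c+n<Wv av≡1 | low Wu≤c′ au≡0  = crossing-down 0<n c+n<Wv Wu≤c′ av≡1 au≡0

  transpose-ˡ : ∀ {n} (i j : Fin n) → transpose i j i ≡ j
  transpose-ˡ i j rewrite dec-true (i ≟ i) refl = refl

  transpose-ʳ : ∀ {n} (i j : Fin n) → transpose i j j ≡ i
  transpose-ʳ i j with j ≟ i
  ... | yes j≡i = j≡i
  ... | no  _   rewrite dec-true (j ≟ j) refl = refl

  transpose-other : ∀ {n} {i j k : Fin n} → k ≢ i → k ≢ j → transpose i j k ≡ k
  transpose-other {i = i} {j} {k} k≢i k≢j rewrite dec-false (k ≟ i) k≢i | dec-false (k ≟ j) k≢j = refl

  transpose-comm : ∀ {n} (i j k : Fin n) → transpose i j k ≡ transpose j i k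
  transpose-comm i j k = by-cases (k ≟ i) (k ≟ j)
    where
    by-cases : Dec (k ≡ i) → Dec (k ≡ j) → transpose i j k ≡ transpose j i k
    by-cases (yes refl) _          = trans (transpose-ˡ k j) (sym (transpose-ʳ j k))
    by-cases (no _)     (yes refl) = trans (transpose-ʳ i k) (sym (transpose-ˡ k i))
    by-cases (no k≢i)   (no k≢j)   = trans (transpose-other k≢i k≢j) (sym (transpose-other k≢j k≢i))

  data Next {n} (i j : Fin n) : Set where
    inner : toℕ j ≡ suc (toℕ i) → Next i j
    wrap  : toℕ j ≡ 0 → suc (toℕ i) ≡ n → Next i j

  seam : ∀ {n} {i j : Fin n} → Next i j → ℤ
  seam (inner _)  = 0ℤ
  seam (wrap _ _) = 1ℤ

  next-toℕ : ∀ {n} {i j : Fin n} (nx : Next i j) → + toℕ j + + n * seam nx ≡ + toℕ i + 1ℤ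
  next-toℕ {n} {i} (inner j≡1+i) rewrite j≡1+i | *-zeroʳ (+ n) =
    trans (+-identityʳ _) (+-comm 1ℤ (+ toℕ i))
  next-toℕ {n} {i} (wrap j≡0 1+i≡n) rewrite j≡0 | *-identityʳ (+ n) =
    trans (cong +_ (sym 1+i≡n)) (+-comm 1ℤ (+ toℕ i))

  next? : ∀ {n} (i j : Fin n) → Dec (Next i j)
  next? {n} i j with toℕ j ℕ.≟ suc (toℕ i) | toℕ j ℕ.≟ 0 | suc (toℕ i) ℕ.≟ n
  ... | yes j≡1+i | _       | _         = yes (inner j≡1+i)
  ... | no  j≢1+i | yes j≡0 | yes 1+i≡n = yes (wrap j≡0 1+i≡n)
  ... | no  j≢1+i | no  j≢0 | _         =
    no λ { (inner j≡1+i) → j≢1+i j≡1+i ; (wrap j≡0 _) → j≢0 j≡0 }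
  ... | no  j≢1+i | yes _   | no  1+i≢n =
    no λ { (inner j≡1+i) → j≢1+i j≡1+i ; (wrap _ 1+i≡n) → 1+i≢n 1+i≡n }

  next⇒cycleAdj : ∀ {n} {i j : Fin n} → Next i j → i ≢ j → CycleAdj n i j
  next⇒cycleAdj (inner j≡1+i)     i≢j = i≢j , inj₁ j≡1+i
  next⇒cycleAdj (wrap j≡0 1+i≡n) i≢j = i≢j , inj₂ (inj₂ (inj₂ (j≡0 , 1+i≡n)))

  cycleAdj⇒next : ∀ {n} {i j : Fin n} → CycleAdj n i j → Next i j ⊎ Next j i
  cycleAdj⇒next (_ , inj₁ j≡1+i)                   = inj₁ (inner j≡1+i)
  cycleAdj⇒next (_ , inj₂ (inj₁ i≡1+j))            = inj₂ (inner i≡1+j)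
  cycleAdj⇒next (_ , inj₂ (inj₂ (inj₁ (i≡0 , 1+j≡n)))) = inj₂ (wrap i≡0 1+j≡n)
  cycleAdj⇒next (_ , inj₂ (inj₂ (inj₂ (j≡0 , 1+i≡n)))) = inj₁ (wrap j≡0 1+i≡n)

  ≢⇒1<n : ∀ {n} {i j : Fin n} → i ≢ j → 1 ℕ.< n
  ≢⇒1<n {suc zero}    {zero} {zero} i≢j = contradiction refl i≢j
  ≢⇒1<n {suc (suc _)} _                 = s≤s (s≤s z≤n)

  cyclic-mono⇒const : ∀ {n} (g : Fin n → ℤ) → (∀ i j → Next i j → g i ≤ g j) →
                      ∀ i j → g i ≡ g j
  cyclic-mono⇒const {suc m} g mono i j = trans (≡g₀ i) (sym (≡g₀ j))
    where
    forward : ∀ k → Next (inject₁ k) (suc k)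
    forward k = inner (cong suc (sym (toℕ-inject₁ k)))

    g₀≤ : ∀ k → g zero ≤ g k
    g₀≤ = <-weakInduction (λ k → g zero ≤ g k) ≤-refl
            (λ k g₀≤gk → ≤-trans g₀≤gk (mono _ _ (forward k)))

    ≤gₘ : ∀ k → g k ≤ g (fromℕ m)
    ≤gₘ = >-weakInduction (λ k → g k ≤ g (fromℕ m)) ≤-refl
            (λ k gk≤gₘ → ≤-trans (mono _ _ (forward k)) gk≤gₘ)

    ≡g₀ : ∀ k → g k ≡ g zero
    ≡g₀ k = ≤-antisym (≤-trans (≤gₘ k) (mono _ _ (wrap refl (cong suc (toℕ-fromℕ m)))))
                      (g₀≤ k)

  -- Lifts to the universal cover of the cycle

  borrow : ℕ → ℕ → ℤ
  borrow a b = if does (a ℕ.<? b) then 1ℤ else 0ℤ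

  borrow-< : ∀ {a b} → a ℕ.< b → borrow a b ≡ 1ℤ
  borrow-< {a} {b} a<b rewrite dec-true (a ℕ.<? b) a<b = refl

  borrow-≮ : ∀ {a b} → ¬ a ℕ.< b → borrow a b ≡ 0ℤ
  borrow-≮ {a} {b} a≮b rewrite dec-false (a ℕ.<? b) a≮b = refl

  borrow-self : ∀ a → borrow a a ≡ 0ℤ
  borrow-self a = borrow-≮ {a} (ℕ.<-irrefl refl)

  borrow-bounds : ∀ a b → 0ℤ ≤ borrow a b × borrow a b ≤ 1ℤ
  borrow-bounds a b with a ℕ.<? b
  ... | yes a<b rewrite borrow-< a<b = +≤+ z≤n , ≤-refl
  ... | no  a≮b rewrite borrow-≮ a≮b = ≤-refl , +≤+ z≤n

  borrow-floor : ∀ {n a b} → a ℕ.< n → b ℕ.< n → a ≢ b →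
                 StrictFloor n (+ a - + b) (- borrow a b)
  borrow-floor {n} {a} {b} a<n b<n a≢b with a ℕ.<? b
  ... | yes a<b rewrite borrow-< a<b = strictFloor
    (begin-strict
      + n * -1ℤ   ≡⟨ *-comm (+ n) -1ℤ ⟩
      -1ℤ * + n   ≡⟨ -1*i≡-i (+ n) ⟩
      - + n       <⟨ neg-mono-< (+<+ b<n) ⟩
      - + b       ≤⟨ i≤j+i (- + b) (+ a) ⟩
      + a - + b   ∎)
    (begin-strict
      + a - + b   <⟨ +-monoˡ-< (- + b) (+<+ a<b) ⟩
      + b - + b   ≡⟨ +-inverseʳ (+ b) ⟩
      0ℤ          ≡⟨ cancel (+ n) ⟨
      + n * -1ℤ + + n ∎)
    where
    open ≤-Reasoning
    cancel : ∀ n → n * -1ℤ + n ≡ 0ℤ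
    cancel = solve-∀
  ... | no  a≮b rewrite borrow-≮ a≮b = strictFloor
    (begin-strict
      + n * 0ℤ    ≡⟨ *-zeroʳ (+ n) ⟩
      0ℤ          ≡⟨ +-inverseʳ (+ b) ⟨
      + b - + b   <⟨ +-monoˡ-< (- + b) (+<+ (ℕ.≤∧≢⇒< (ℕ.≮⇒≥ a≮b) (a≢b ∘ sym))) ⟩
      + a - + b   ∎)
    (begin-strict
      + a - + b   ≤⟨ i-j≤i (+ a) (+ b) ⟩
      + a         <⟨ +<+ a<n ⟩
      + n         ≡⟨ trans (cong (_+ + n) (*-zeroʳ (+ n))) (+-identityˡ (+ n)) ⟨
      + n * 0ℤ + + n ∎)
    where open ≤-Reasoning

  record Lift (n : ℕ) : Set where
    field
      arrangement : Permutation′ n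
      winding     : Fin n → ℤ
  open Lift

  module _ {n : ℕ} where

    label : Lift n → Fin n → Fin n
    label s i = arrangement s ⟨$⟩ʳ i

    pos : Lift n → Fin n → Fin n
    pos s v = arrangement s ⟨$⟩ˡ v

    label-pos : ∀ s v → label s (pos s v) ≡ v
    label-pos s v = inverseʳ (arrangement s)

    pos-label : ∀ s i → pos s (label s i) ≡ i
    pos-label s i = inverseˡ (arrangement s)

    pos≡⇒≡label : ∀ s {v i} → pos s v ≡ i → v ≡ label s i
    pos≡⇒≡label s {v} e = trans (sym (label-pos s v)) (cong (label s) e)

    pos-injective : ∀ s {u v} → pos s u ≡ pos s v → u ≡ v
    pos-injective s {u} {v} e = trans (pos≡⇒≡label s e) (label-pos s v)

    height : Lift n → Fin n → ℤ
    height s v = + n * winding s v + + toℕ (pos s v)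

    displacement : Lift n → Lift n → Fin n → ℤ
    displacement s t v = height t v - height s v

    -- How many full turns v is ahead of u.
    laps : Lift n → Fin n → Fin n → ℤ
    laps s u v = winding s v - winding s u - borrow (toℕ (pos s v)) (toℕ (pos s u))

    height-floor : ∀ s v → Floor n (height s v) (winding s v)
    height-floor s v = floor (i≤i+j _ (+ toℕ (pos s v)))
                             (+-monoʳ-< (+ n * winding s v) (+<+ (toℕ<n (pos s v))))

    laps-floor : ∀ s {u v} → u ≢ v → StrictFloor n (height s v - height s u) (laps s u v)
    laps-floor s {u} {v} u≢v =
      subst (λ d → StrictFloor n d (laps s u v))
            (split (+ n) (winding s v) (winding s u) (+ toℕ (pos s v)) (+ toℕ (pos s u)))
            (strictFloor-shift (winding s v - winding s u)
              (borrow-floor (toℕ<n _) (toℕ<n _)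
                            (u≢v ∘ sym ∘ pos-injective s ∘ toℕ-injective)))
      where
      split : ∀ n wv wu pv pu → n * (wv - wu) + (pv - pu) ≡ n * wv + pv - (n * wu + pu)
      split = solve-∀

    laps-self : ∀ s v → laps s v v ≡ 0ℤ
    laps-self s v rewrite borrow-self (toℕ (pos s v)) | +-inverseʳ (winding s v) = refl

    laps-antisym : ∀ s {u v} → u ≢ v → laps s v u ≡ -1ℤ - laps s u v
    laps-antisym s {u} {v} u≢v = strictFloor-unique (laps-floor s (u≢v ∘ sym))
      (subst (λ d → StrictFloor n d (-1ℤ - laps s u v))
             (flip (height s v) (height s u))
             (strictFloor-neg (laps-floor s u≢v)))
      where
      flip : ∀ a b → - (a - b) ≡ b - a
      flip = solve-∀

    borrow-next : ∀ {i j : Fin n} (nx : Next i j) → i ≢ j → borrow (toℕ j) (toℕ i) ≡ seam nx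
    borrow-next {i} (inner j≡1+i) _ =
      borrow-≮ (λ j<i → ℕ.<-asym (subst (ℕ._< toℕ i) j≡1+i j<i) (ℕ.n<1+n (toℕ i)))
    borrow-next {i} {j} (wrap j≡0 _) i≢j rewrite j≡0 =
      borrow-< (ℕ.n≢0⇒n>0 (λ i≡0 → i≢j (toℕ-injective (trans i≡0 (sym j≡0)))))

    height-next : ∀ s {i j} (nx : Next i j) → i ≢ j →
                  height s (label s j) - height s (label s i) ≡ + n * laps s (label s i) (label s j) + 1ℤ
    height-next s {i} {j} nx i≢j rewrite pos-label s i | pos-label s j | borrow-next nx i≢j =
      carry (+ n) (winding s (label s j)) (winding s (label s i)) (seam nx) (+ toℕ j) (+ toℕ i)
            (next-toℕ nx)
      where
      carry : ∀ N wj wi c j i → j + N * c ≡ i + 1ℤ →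
              N * wj + j - (N * wi + i) ≡ N * (wj - wi - c) + 1ℤ
      carry N wj wi c j i j+Nc≡i+1 = begin
        N * wj + j - (N * wi + i)              ≡⟨ regroup N wj wi c j i ⟩
        N * (wj - wi - c) + (j + N * c) - i    ≡⟨ cong (λ x → N * (wj - wi - c) + x - i) j+Nc≡i+1 ⟩
        N * (wj - wi - c) + (i + 1ℤ) - i       ≡⟨ cancel (N * (wj - wi - c)) i ⟩
        N * (wj - wi - c) + 1ℤ                 ∎
        where
        open ≡-Reasoning
        regroup : ∀ N wj wi c j i → N * wj + j - (N * wi + i) ≡ N * (wj - wi - c) + (j + N * c) - i
        regroup = solve-∀
        cancel : ∀ x i → x + (i + 1ℤ) - i ≡ x + 1ℤ
        cancel = solve-∀

    label-≢ : ∀ s {i j} → i ≢ j → label s i ≢ label s j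
    label-≢ s {i} {j} i≢j e = i≢j (trans (sym (pos-label s i)) (trans (cong (pos s) e) (pos-label s j)))

    shift : Lift n → Fin n → Fin n → Fin n → ℤ
    shift s i j p = δ (label s i) p - δ (label s j) p

    -- Exchange the labels at the consecutive positions i and j; the label crossing the seam
    -- from position n - 1 to 0 gains a turn, the other one loses it.
    swap : (s : Lift n) {i j : Fin n} → Next i j → Lift n
    swap s {i} {j} nx = record
      { arrangement = Perm.transpose i j ∘ₚ arrangement s
      ; winding     = λ p → winding s p + seam nx * shift s i j p
      }

    height-swap : ∀ s {i j} (nx : Next i j) → i ≢ j →
                  ∀ p → height (swap s nx) p ≡ height s p + shift s i j p
    height-swap s {i} {j} nx i≢j p = by-cases (p ≟ label s i) (p ≟ label s j)
      where
      u≢v : label s i ≢ label s j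
      u≢v = label-≢ s i≢j

      by-cases : Dec (p ≡ label s i) → Dec (p ≡ label s j) →
                 height (swap s nx) p ≡ height s p + shift s i j p
      by-cases (yes refl) _
        rewrite δ-same (label s i) | δ-other u≢v | pos-label s i | transpose-ʳ j i =
          forward (+ n) (winding s p) (seam nx) (+ toℕ i) (+ toℕ j) (next-toℕ nx)
        where
        forward : ∀ N w c i j → j + N * c ≡ i + 1ℤ →
                  N * (w + c * (1ℤ - 0ℤ)) + j ≡ N * w + i + (1ℤ - 0ℤ)
        forward N w c i j j+Nc≡i+1 =
          trans (regroup₁ N w c j) (trans (cong (_+_ (N * w)) j+Nc≡i+1) (regroup₂ (N * w) i))
          where
          regroup₁ : ∀ N w c j → N * (w + c * (1ℤ - 0ℤ)) + j ≡ N * w + (j + N * c)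
          regroup₁ = solve-∀
          regroup₂ : ∀ x i → x + (i + 1ℤ) ≡ x + i + (1ℤ - 0ℤ)
          regroup₂ = solve-∀
      by-cases (no p≢u) (yes refl)
        rewrite δ-same (label s j) | δ-other p≢u | pos-label s j | transpose-ˡ j i =
          backward (+ n) (winding s p) (seam nx) (+ toℕ i) (+ toℕ j) (next-toℕ nx)
        where
        backward : ∀ N w c i j → j + N * c ≡ i + 1ℤ →
                   N * (w + c * (0ℤ - 1ℤ)) + i ≡ N * w + j + (0ℤ - 1ℤ)
        backward N w c i j j+Nc≡i+1 = trans (regroup₁ N w c i) (trans
          (cong (λ x → N * w + x - 1ℤ - N * c) (sym j+Nc≡i+1)) (regroup₂ N w c j))
          where
          regroup₁ : ∀ N w c i → N * (w + c * (0ℤ - 1ℤ)) + i ≡ N * w + (i + 1ℤ) - 1ℤ - N * c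
          regroup₁ = solve-∀
          regroup₂ : ∀ N w c j → N * w + (j + N * c) - 1ℤ - N * c ≡ N * w + j + (0ℤ - 1ℤ)
          regroup₂ = solve-∀
      by-cases (no p≢u) (no p≢v)
        rewrite δ-other p≢u | δ-other p≢v
              | transpose-other {i = j} {i} (p≢v ∘ pos≡⇒≡label s) (p≢u ∘ pos≡⇒≡label s) =
          unmoved (+ n) (winding s p) (seam nx) (+ toℕ (pos s p))
        where
        unmoved : ∀ N w c x → N * (w + c * (0ℤ - 0ℤ)) + x ≡ N * w + x + (0ℤ - 0ℤ)
        unmoved = solve-∀

    sum-shift : ∀ s i j → sum (shift s i j) ≡ 0ℤ
    sum-shift s i j = begin
      sum (λ p → δ u p - δ v p)          ≡⟨ ∑-distrib-+ (δ u) (λ p → - δ v p) ⟩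
      sum (δ u) + sum (λ p → - δ v p)    ≡⟨ cong (_+_ (sum (δ u))) (sum-neg (δ v)) ⟩
      sum (δ u) - sum (δ v)              ≡⟨ cong₂ _-_ (sum-δ u) (sum-δ v) ⟩
      1ℤ - 1ℤ                            ∎
      where
      open ≡-Reasoning
      u v : Fin n
      u = label s i
      v = label s j

    sum-height-swap : ∀ s {i j} (nx : Next i j) → i ≢ j → sum (height (swap s nx)) ≡ sum (height s)
    sum-height-swap s {i} {j} nx i≢j = begin
      sum (height (swap s nx))                ≡⟨ sum-cong-≗ (height-swap s nx i≢j) ⟩
      sum (λ p → height s p + shift s i j p)  ≡⟨ ∑-distrib-+ (height s) (shift s i j) ⟩
      sum (height s) + sum (shift s i j)      ≡⟨ cong (_+_ (sum (height s))) (sum-shift s i j) ⟩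
      sum (height s) + 0ℤ                     ≡⟨ +-identityʳ _ ⟩
      sum (height s)                          ∎
      where open ≡-Reasoning

    shift-ˡ : ∀ s {i j} → i ≢ j → shift s i j (label s i) ≡ 1ℤ
    shift-ˡ s {i} i≢j rewrite δ-same (label s i) | δ-other (label-≢ s i≢j) = refl

    shift-ʳ : ∀ s {i j} → i ≢ j → shift s i j (label s j) ≡ -1ℤ
    shift-ʳ s {i} {j} i≢j rewrite δ-same (label s j) | δ-other (label-≢ s i≢j ∘ sym) = refl

    shift-diff-≤1 : ∀ s {i j p q} → ¬ (p ≡ label s j × q ≡ label s i) →
                    shift s i j q - shift s i j p ≤ 1ℤ
    shift-diff-≤1 s {i} {j} {p} {q} ¬p≡v×q≡u = begin
      (δ u q - δ v q) - (δ u p - δ v p)    ≡⟨ regroup (δ u q) (δ v q) (δ u p) (δ v p) ⟩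
      (δ u q + δ v p) - (δ v q + δ u p)    ≤⟨ +-monoʳ-≤ (δ u q + δ v p)
                                               (neg-mono-≤ (+-mono-≤ (proj₁ (δ-bounds v q))
                                                                     (proj₁ (δ-bounds u p)))) ⟩
      (δ u q + δ v p) + 0ℤ                 ≡⟨ +-identityʳ _ ⟩
      δ u q + δ v p                        ≤⟨ δ-pair-≤1 (λ (q≡u , p≡v) → ¬p≡v×q≡u (p≡v , q≡u)) ⟩
      1ℤ                                   ∎
      where
      open ≤-Reasoning
      u v : Fin n
      u = label s i
      v = label s j
      regroup : ∀ a b c d → (a - b) - (c - d) ≡ (a + d) - (b + c)
      regroup = solve-∀

    height-diff-swap : ∀ s {i j} (nx : Next i j) → i ≢ j → ∀ p q →
      height (swap s nx) q - height (swap s nx) p ≡ (height s q - height s p) + (shift s i j q - shift s i j p)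
    height-diff-swap s {i} {j} nx i≢j p q =
      trans (cong₂ _-_ (height-swap s nx i≢j q) (height-swap s nx i≢j p))
            (regroup (height s q) (shift s i j q) (height s p) (shift s i j p))
      where
      regroup : ∀ a b c d → (a + b) - (c + d) ≡ (a - c) + (b - d)
      regroup = solve-∀

    -- The height difference of any other pair moves by at most one, so it cannot cross a multiple of n.
    laps-swap-other : ∀ s {i j} (nx : Next i j) → i ≢ j → ∀ {p q} → p ≢ q →
                      ¬ (p ≡ label s i × q ≡ label s j) → ¬ (p ≡ label s j × q ≡ label s i) →
                      laps (swap s nx) p q ≡ laps s p q
    laps-swap-other s {i} {j} nx i≢j {p} {q} p≢q ¬uv ¬vu = sym (strictFloor-stable
      (laps-floor s p≢q)
      (subst (λ d → StrictFloor n d (laps (swap s nx) p q)) (height-diff-swap s nx i≢j p q)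
             (laps-floor (swap s nx) p≢q))
      (-1≤ (subst (_≤ 1ℤ) (flip (shift s i j q) (shift s i j p))
                  (shift-diff-≤1 s (λ (q≡v , p≡u) → ¬uv (p≡u , q≡v)))))
      (shift-diff-≤1 s ¬vu))
      where
      flip : ∀ a b → b - a ≡ - (a - b)
      flip = solve-∀
      -1≤ : ∀ {x} → - x ≤ 1ℤ → -1ℤ ≤ x
      -1≤ {x} -x≤1 = subst (-1ℤ ≤_) (neg-involutive x) (neg-mono-≤ -x≤1)

    laps-swap-forward : ∀ s {i j} (nx : Next i j) → i ≢ j →
                        laps (swap s nx) (label s i) (label s j) ≡ laps s (label s i) (label s j) - 1ℤ
    laps-swap-forward s {i} {j} nx i≢j = strictFloor-unique
      (laps-floor (swap s nx) (label-≢ s i≢j))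
      (subst (λ d → StrictFloor n d (laps s u v - 1ℤ)) (sym heights)
             (strictFloor-pred (laps s u v) (≢⇒1<n i≢j)))
      where
      open ≡-Reasoning
      u v : Fin n
      u = label s i
      v = label s j
      regroup : ∀ a b → (a - b) + (-1ℤ - 1ℤ) ≡ (a - b) - 1ℤ - 1ℤ
      regroup = solve-∀
      cancel : ∀ x → x + 1ℤ - 1ℤ - 1ℤ ≡ x - 1ℤ
      cancel = solve-∀
      heights : height (swap s nx) v - height (swap s nx) u ≡ + n * laps s u v - 1ℤ
      heights = begin
        height (swap s nx) v - height (swap s nx) u     ≡⟨ height-diff-swap s nx i≢j u v ⟩
        (height s v - height s u) + (shift s i j v - shift s i j u)
                                 ≡⟨ cong (λ x → (height s v - height s u) + x)
                                         (cong₂ _-_ (shift-ʳ s i≢j) (shift-ˡ s i≢j)) ⟩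
        (height s v - height s u) + (-1ℤ - 1ℤ)          ≡⟨ regroup (height s v) (height s u) ⟩
        (height s v - height s u) - 1ℤ - 1ℤ             ≡⟨ cong (λ x → x - 1ℤ - 1ℤ) (height-next s nx i≢j) ⟩
        + n * laps s u v + 1ℤ - 1ℤ - 1ℤ                 ≡⟨ cancel (+ n * laps s u v) ⟩
        + n * laps s u v - 1ℤ                           ∎

    laps-swap-backward : ∀ s {i j} (nx : Next i j) → i ≢ j →
                         laps (swap s nx) (label s j) (label s i) ≡ laps s (label s j) (label s i) + 1ℤ
    laps-swap-backward s {i} {j} nx i≢j = begin
      laps (swap s nx) v u            ≡⟨ laps-antisym (swap s nx) u≢v ⟩
      -1ℤ - laps (swap s nx) u v      ≡⟨ cong (_-_ -1ℤ) (laps-swap-forward s nx i≢j) ⟩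
      -1ℤ - (laps s u v - 1ℤ)         ≡⟨ regroup (laps s u v) ⟩
      (-1ℤ - laps s u v) + 1ℤ         ≡⟨ cong (_+ 1ℤ) (laps-antisym s u≢v) ⟨
      laps s v u + 1ℤ                 ∎
      where
      open ≡-Reasoning
      u v : Fin n
      u = label s i
      v = label s j
      u≢v : u ≢ v
      u≢v = label-≢ s i≢j
      regroup : ∀ x → -1ℤ - (x - 1ℤ) ≡ (-1ℤ - x) + 1ℤ
      regroup = solve-∀

    laps-swap : ∀ s {i j} (nx : Next i j) → i ≢ j → ∀ p q →
                laps (swap s nx) p q ≡ laps s p q
                ⊎ (p ≡ label s i × q ≡ label s j) ⊎ (p ≡ label s j × q ≡ label s i)
    laps-swap s {i} {j} nx i≢j p q
      with p ≟ q | p ≟ label s i ×-dec q ≟ label s j | p ≟ label s j ×-dec q ≟ label s i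
    ... | yes refl | _        | _        = inj₁ (trans (laps-self (swap s nx) p) (sym (laps-self s p)))
    ... | no _     | yes uv   | _        = inj₂ (inj₁ uv)
    ... | no _     | no _     | yes vu   = inj₂ (inj₂ vu)
    ... | no p≢q   | no ¬uv   | no ¬vu   = inj₁ (laps-swap-other s nx i≢j p≢q ¬uv ¬vu)

    laps-bounds : ∀ s p q → laps s p q ≤ winding s q - winding s p
                          × winding s q - winding s p ≤ laps s p q + 1ℤ
    laps-bounds s p q =
        (begin
          Δ - b          ≤⟨ +-monoʳ-≤ Δ (neg-mono-≤ 0≤b) ⟩
          Δ + 0ℤ         ≡⟨ +-identityʳ Δ ⟩
          Δ              ∎)
      , (begin
          Δ              ≡⟨ cancel Δ b ⟨
          Δ - b + b      ≤⟨ +-monoʳ-≤ (Δ - b) b≤1 ⟩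
          Δ - b + 1ℤ     ∎)
      where
      open ≤-Reasoning
      Δ b : ℤ
      Δ = winding s q - winding s p
      b = borrow (toℕ (pos s q)) (toℕ (pos s p))
      0≤b : 0ℤ ≤ b
      0≤b = proj₁ (borrow-bounds (toℕ (pos s q)) (toℕ (pos s p)))
      b≤1 : b ≤ 1ℤ
      b≤1 = proj₂ (borrow-bounds (toℕ (pos s q)) (toℕ (pos s p)))
      cancel : ∀ Δ b → Δ - b + b ≡ Δ
      cancel = solve-∀

    laps-drop : ∀ t s {i j} (nx : Next i j) → i ≢ j →
                displacement s t (label s j) < displacement s t (label s i) →
                laps t (label s i) (label s j) < laps s (label s i) (label s j)
    laps-drop t s {i} {j} nx i≢j drop = *-cancelˡ-<-nonNeg (+ n) (begin-strict
      + n * laps t u v           <⟨ StrictFloor.lower (laps-floor t (label-≢ s i≢j)) ⟩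
      height t v - height t u    ≤⟨ <+1⇒≤ (subst (height t v - height t u <_) (height-next s nx i≢j) closer) ⟩
      + n * laps s u v           ∎)
      where
      open ≤-Reasoning
      u v : Fin n
      u = label s i
      v = label s j
      closer : height t v - height t u < height s v - height s u
      closer = a-b<c-d⇒a-c<b-d (height t v) (height s v) (height t u) (height s u) drop

    pos-from-height : ∀ s t {p} → height s p ≡ height t p → pos s p ≡ pos t p
    pos-from-height s t {p} same = toℕ-injective (+-injective (begin
      + toℕ (pos s p)                    ≡⟨ recover (+ n * winding s p) _ ⟩
      height s p - + n * winding s p     ≡⟨ cong₂ (λ h w → h - + n * w) same windings ⟩
      height t p - + n * winding t p     ≡⟨ recover (+ n * winding t p) _ ⟨
      + toℕ (pos t p)                    ∎))
      where
      open ≡-Reasoning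
      windings : winding s p ≡ winding t p
      windings = floor-unique (height-floor s p) (subst (λ h → Floor n h _) (sym same) (height-floor t p))
      recover : ∀ a b → b ≡ a + b - a
      recover = solve-∀

    -- The sum of heights pins down the rotation of the cycle.
    arrive : ∀ s t → sum (height s) ≡ sum (height t) →
             (∀ i j → Next i j → displacement s t (label s i) ≤ displacement s t (label s j)) →
             ∀ i → label s i ≡ label t i
    arrive s t sums mono i =
      pos≡⇒≡label t (trans (sym (pos-from-height s t (same-height (label s i)))) (pos-label s i))
      where
      c : ℤ
      c = displacement s t (label s i)

      shifted : ∀ p → height t p ≡ height s p + c
      shifted p = trans (regroup (height t p) (height s p)) (cong (_+_ (height s p)) (trans
        (cong (displacement s t) (sym (label-pos s p)))
        (cyclic-mono⇒const (displacement s t ∘ label s) mono (pos s p) i)))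
        where
        regroup : ∀ a b → a ≡ b + (a - b)
        regroup = solve-∀

      c≡0 : c ≡ 0ℤ
      c≡0 = translate-sum-zero (ℕ.≤-<-trans z≤n (toℕ<n i)) shifted sums

      same-height : ∀ p → height s p ≡ height t p
      same-height p = sym (trans (shifted p) (trans (cong (_+_ (height s p)) c≡0) (+-identityʳ _)))

  flat : ∀ {n} → Permutation′ n → Lift n
  flat σ = record { arrangement = σ ; winding = λ _ → 0ℤ }

  rewind : ∀ {n} → Lift n → (Fin n → ℤ) → Lift n
  rewind t W = record { arrangement = arrangement t ; winding = W }

  module _ {n : ℕ} where

    laps-flat-bounds : ∀ (σ : Permutation′ n) p q → -1ℤ ≤ laps (flat σ) p q × laps (flat σ) p q ≤ 0ℤ
    laps-flat-bounds σ p q =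
        subst (-1ℤ ≤_) (sym (+-identityˡ (- b))) (neg-mono-≤ (proj₂ (borrow-bounds Pq Pp)))
      , subst (_≤ 0ℤ) (sym (+-identityˡ (- b))) (neg-mono-≤ (proj₁ (borrow-bounds Pq Pp)))
      where
      Pp Pq : ℕ
      Pp = toℕ (pos (flat σ) p)
      Pq = toℕ (pos (flat σ) q)
      b : ℤ
      b = borrow Pq Pp

    windings-close : ∀ (σ : Permutation′ n) t {p q} → laps (flat σ) p q ≡ laps t p q →
                     -1ℤ ≤ winding t q - winding t p × winding t q - winding t p ≤ 1ℤ
    windings-close σ t {p} {q} same =
        (begin
          -1ℤ                       ≤⟨ proj₁ (laps-flat-bounds σ p q) ⟩
          laps (flat σ) p q         ≡⟨ same ⟩
          laps t p q                ≤⟨ proj₁ (laps-bounds t p q) ⟩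
          winding t q - winding t p ∎)
      , (begin
          winding t q - winding t p ≤⟨ proj₂ (laps-bounds t p q) ⟩
          laps t p q + 1ℤ           ≡⟨ cong (_+ 1ℤ) same ⟨
          laps (flat σ) p q + 1ℤ    ≤⟨ +-monoˡ-≤ 1ℤ (proj₂ (laps-flat-bounds σ p q)) ⟩
          1ℤ                        ∎)
      where open ≤-Reasoning

  -- Walks in FS(Cycle n, Y)

  fsStep-transpose : ∀ {n} {g ρ : Fin n → Fin n} {a b} → ρ a ≡ g b → ρ b ≡ g a →
                     (∀ c → c ≢ a → c ≢ b → ρ c ≡ g c) → ∀ k → ρ k ≡ g (transpose a b k)
  fsStep-transpose {g = g} {ρ} {a} {b} ρa ρb ρc k = by-cases (k ≟ a) (k ≟ b)
    where
    by-cases : Dec (k ≡ a) → Dec (k ≡ b) → ρ k ≡ g (transpose a b k)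
    by-cases (yes refl) _          = trans ρa (cong g (sym (transpose-ˡ k b)))
    by-cases (no _)     (yes refl) = trans ρb (cong g (sym (transpose-ʳ a k)))
    by-cases (no k≢a)   (no k≢b)   = trans (ρc k k≢a k≢b) (cong g (sym (transpose-other k≢a k≢b)))

  walk-cong : ∀ {n} {X Y : SimpleGraph n} {g h h′ k} →
              FSWalk X Y g h k → (∀ i → h i ≡ h′ i) → FSWalk X Y g h′ k
  walk-cong (stay g≗h)     h≗h′ = stay (λ i → trans (g≗h i) (h≗h′ i))
  walk-cong (step st walk) h≗h′ = step st (walk-cong walk h≗h′)

  module _ {n : ℕ} (Y : SimpleGraph n) where

    infix 4 _∼_
    record _∼_ (s t : Lift n) : Set where
      constructor mk∼
      field
        laps-agree : ∀ p q → laps s p q ≡ laps t p q ⊎ Adj Y p q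
        sum-height : sum (height s) ≡ sum (height t)
    open _∼_

    ∼-refl : ∀ {s} → s ∼ s
    ∼-refl = mk∼ (λ p q → inj₁ refl) refl

    ∼-sym : ∀ {s t} → s ∼ t → t ∼ s
    ∼-sym (mk∼ agree sums) = mk∼ (λ p q → Sum.map₁ sym (agree p q)) (sym sums)

    ∼-trans : ∀ {r s t} → r ∼ s → s ∼ t → r ∼ t
    ∼-trans {r} {s} {t} (mk∼ agree₁ sums₁) (mk∼ agree₂ sums₂) = mk∼ agree (trans sums₁ sums₂)
      where
      agree : ∀ p q → laps r p q ≡ laps t p q ⊎ Adj Y p q
      agree p q with agree₁ p q | agree₂ p q
      ... | inj₁ r≡s | inj₁ s≡t = inj₁ (trans r≡s s≡t)
      ... | inj₂ adj | _        = inj₂ adj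
      ... | inj₁ _   | inj₂ adj = inj₂ adj

    swap-∼ : ∀ s {i j} (nx : Next i j) → i ≢ j → Adj Y (label s i) (label s j) → s ∼ swap s nx
    swap-∼ s nx i≢j adj = mk∼ agree (sym (sum-height-swap s nx i≢j))
      where
      agree : ∀ p q → laps s p q ≡ laps (swap s nx) p q ⊎ Adj Y p q
      agree p q with laps-swap s nx i≢j p q
      ... | inj₁ same                  = inj₁ (sym same)
      ... | inj₂ (inj₁ (refl , refl)) = inj₂ adj
      ... | inj₂ (inj₂ (refl , refl)) = inj₂ (adj-sym Y adj)

    swap-along : ∀ s {a b} → CycleAdj n a b → Adj Y (label s a) (label s b) →
                 Σ (Lift n) λ s′ → (∀ k → label s′ k ≡ label s (transpose a b k)) × s ∼ s′
    swap-along s {a} {b} ab adj with cycleAdj⇒next ab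
    ... | inj₁ nx = swap s nx , (λ k → refl) , swap-∼ s nx (proj₁ ab) adj
    ... | inj₂ nx = swap s nx , (λ k → cong (label s) (transpose-comm b a k))
                  , swap-∼ s nx (proj₁ ab ∘ sym) (adj-sym Y adj)

    lift-walk : ∀ {g h k} s → (∀ i → label s i ≡ g i) → FSWalk (Cycle n) Y g h k →
                Σ (Lift n) λ t → (∀ i → label t i ≡ h i) × s ∼ t
    lift-walk s s≗g (stay g≗h) = s , (λ i → trans (s≗g i) (g≗h i)) , ∼-refl
    lift-walk s s≗g (step (a , b , ab , adj , ρa , ρb , ρc) walk)
      with swap-along s ab (subst₂ (Adj Y) (sym (s≗g a)) (sym (s≗g b)) adj)
    ... | s′ , s′≗ , s∼s′
      with lift-walk s′ (λ k → trans (s′≗ k) (trans (s≗g _) (sym (fsStep-transpose ρa ρb ρc k)))) walk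
    ...   | t , t≗h , s′∼t = t , t≗h , ∼-trans s∼s′ s′∼t

    distance : Lift n → Lift n → ℕ
    distance s t = sumℕ (λ p → sumℕ (λ q → ∣ laps t p q - laps s p q ∣))

    distance-swap : ∀ t s {i j} (nx : Next i j) → i ≢ j →
                    laps t (label s i) (label s j) < laps s (label s i) (label s j) →
                    distance (swap s nx) t ℕ.< distance s t
    distance-swap t s {i} {j} nx i≢j drop = sumℕ²-mono-< closer u v forward
      where
      u v : Fin n
      u = label s i
      v = label s j

      forward : ∣ laps t u v - laps (swap s nx) u v ∣ ℕ.< ∣ laps t u v - laps s u v ∣
      forward = subst (λ x → ∣ laps t u v - x ∣ ℕ.< ∣ laps t u v - laps s u v ∣)
                      (sym (laps-swap-forward s nx i≢j)) (∣a-[b-1]∣<∣a-b∣ drop)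

      rise : laps s v u < laps t v u
      rise = subst₂ _<_ (sym (laps-antisym s (label-≢ s i≢j))) (sym (laps-antisym t (label-≢ s i≢j)))
                    (+-monoʳ-< -1ℤ (neg-mono-< drop))

      backward : ∣ laps t v u - laps (swap s nx) v u ∣ ℕ.< ∣ laps t v u - laps s v u ∣
      backward = subst (λ x → ∣ laps t v u - x ∣ ℕ.< ∣ laps t v u - laps s v u ∣)
                       (sym (laps-swap-backward s nx i≢j)) (∣a-[b+1]∣<∣a-b∣ rise)

      closer : ∀ p q → ∣ laps t p q - laps (swap s nx) p q ∣ ℕ.≤ ∣ laps t p q - laps s p q ∣
      closer p q with laps-swap s nx i≢j p q
      ... | inj₁ same                  = ℕ.≤-reflexive (cong (λ x → ∣ laps t p q - x ∣) same)
      ... | inj₂ (inj₁ (refl , refl)) = ℕ.<⇒≤ forward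
      ... | inj₂ (inj₂ (refl , refl)) = ℕ.<⇒≤ backward

    descend : ∀ t s → s ∼ t → Acc ℕ._<_ (distance s t) →
              Σ ℕ λ k → FSWalk (Cycle n) Y (label s) (label t) k × k ℕ.≤ distance s t
    descend t s s∼t (acc smaller)
      with any? (λ i → any? (λ j → next? i j ×-dec
                                   (displacement s t (label s j) <? displacement s t (label s i))))
    ... | no stuck = 0 , stay (arrive s t (sum-height s∼t) monotone) , z≤n
      where
      monotone : ∀ i j → Next i j → displacement s t (label s i) ≤ displacement s t (label s j)
      monotone i j nx = ≮⇒≥ (λ drop → stuck (i , j , nx , drop))
    ... | yes (i , j , nx , drop) =
      extend (descend t (swap s nx) (∼-trans (∼-sym (swap-∼ s nx i≢j adj)) s∼t) (smaller closer))
      where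
      i≢j : i ≢ j
      i≢j refl = <-irrefl refl drop

      fewer-laps : laps t (label s i) (label s j) < laps s (label s i) (label s j)
      fewer-laps = laps-drop t s nx i≢j drop

      closer : distance (swap s nx) t ℕ.< distance s t
      closer = distance-swap t s nx i≢j fewer-laps

      adj : Adj Y (label s i) (label s j)
      adj with laps-agree s∼t (label s i) (label s j)
      ... | inj₁ same = contradiction (sym same) (<⇒≢ fewer-laps)
      ... | inj₂ adj  = adj

      move : FSStep (Cycle n) Y (label s) (label (swap s nx))
      move = i , j , next⇒cycleAdj nx i≢j , adj , cong (label s) (transpose-ˡ i j)
           , cong (label s) (transpose-ʳ i j) , (λ c c≢i c≢j → cong (label s) (transpose-other c≢i c≢j))

      extend : (Σ ℕ λ k → FSWalk (Cycle n) Y (label (swap s nx)) (label t) k × k ℕ.≤ distance (swap s nx) t) →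
               Σ ℕ λ k → FSWalk (Cycle n) Y (label s) (label t) k × k ℕ.≤ distance s t
      extend (k , walk , k≤) = suc k , step move walk , ℕ.<-≤-trans (s≤s k≤) closer

    rewind-∼ : ∀ {r t} (m : Fin n → ℤ) → r ∼ t → sum m ≡ 0ℤ →
               (∀ p q → laps r p q ≡ laps t p q → m p ≡ m q) →
               r ∼ rewind t (λ p → winding t p + m p)
    rewind-∼ {r} {t} m (mk∼ agree sums) sum-m≡0 level = mk∼ agree′ (trans sums (sym sums′))
      where
      t′ : Lift n
      t′ = rewind t (λ p → winding t p + m p)

      agree′ : ∀ p q → laps r p q ≡ laps t′ p q ⊎ Adj Y p q
      agree′ p q with agree p q
      ... | inj₂ adj  = inj₂ adj
      ... | inj₁ same = inj₁ (begin
        laps r p q                   ≡⟨ same ⟩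
        laps t p q                   ≡⟨ +-identityʳ (laps t p q) ⟨
        laps t p q + 0ℤ              ≡⟨ cong (_+_ (laps t p q)) (+-inverseʳ (m q)) ⟨
        laps t p q + (m q - m q)     ≡⟨ cong (λ x → laps t p q + (m q - x)) (level p q same) ⟨
        laps t p q + (m q - m p)     ≡⟨ regroup (winding t q) (winding t p) (m q) (m p) _ ⟩
        laps t′ p q                  ∎)
        where
        open ≡-Reasoning
        regroup : ∀ wq wp mq mp b → wq - wp - b + (mq - mp) ≡ wq + mq - (wp + mp) - b
        regroup = solve-∀

      sums′ : sum (height t′) ≡ sum (height t)
      sums′ = begin
        sum (height t′)                        ≡⟨ sum-cong-≗ (λ p → regroup (+ n) (winding t p) (m p) _) ⟩
        sum (λ p → height t p + + n * m p)     ≡⟨ ∑-distrib-+ (height t) (λ p → + n * m p) ⟩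
        sum (height t) + sum (λ p → + n * m p) ≡⟨ cong (_+_ (sum (height t))) (*-distribˡ-sum (+ n) m) ⟨
        sum (height t) + + n * sum m           ≡⟨ cong (λ x → sum (height t) + + n * x) sum-m≡0 ⟩
        sum (height t) + + n * 0ℤ              ≡⟨ cong (_+_ (sum (height t))) (*-zeroʳ (+ n)) ⟩
        sum (height t) + 0ℤ                    ≡⟨ +-identityʳ _ ⟩
        sum (height t)                         ∎
        where
        open ≡-Reasoning
        regroup : ∀ n w m x → n * (w + m) + x ≡ n * w + x + n * m
        regroup = solve-∀

    rebalance : ∀ (σ : Permutation′ n) t → flat σ ∼ t → Acc ℕ._<_ (spread (winding t)) →
                Σ (Fin n → ℤ) λ W → flat σ ∼ rewind t W × (∀ p q → W q - W p ≤ + (n ℕ.* suc n))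
    rebalance σ t σ∼t (acc smaller)
      with any? (λ u → any? (λ v → + (n ℕ.* suc n) <? winding t v - winding t u))
    ... | no narrow = winding t , σ∼t , λ p q → ≮⇒≥ (λ wide → narrow (p , q , wide))
    ... | yes (u , v , wide) = close-gap (wide⇒gap (winding t) wide)
      where
      close-gap : (∃ λ c → (∀ p → winding t p ≤ c ⊎ c + + n < winding t p)
                           × winding t u ≤ c × c < winding t v) →
                  Σ (Fin n → ℤ) λ W → flat σ ∼ rewind t W × (∀ p q → W q - W p ≤ + (n ℕ.* suc n))
      close-gap (c , gap , Wu≤c , c<Wv) =
        rebalance σ (rewind t closed) (rewind-∼ correction σ∼t sum-correction level)
                  (smaller (spread-closed 0<n Wu≤c c<Wv))
        where
        open CloseGap (winding t) c gap

        0<n : 0 ℕ.< n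
        0<n = ℕ.≤-<-trans z≤n (toℕ<n u)

        level : ∀ p q → laps (flat σ) p q ≡ laps t p q → correction p ≡ correction q
        level p q same = cong (λ a → sum above - + n * a)
          (close⇒same-side 0<n p q (proj₁ (windings-close σ t same)) (proj₂ (windings-close σ t same)))

    distance-flat : ∀ (σ : Permutation′ n) t {K} → (∀ p q → winding t q - winding t p ≤ + K) →
                    distance (flat σ) t ℕ.≤ n ℕ.* (n ℕ.* suc K)
    distance-flat σ t {K} narrow =
      sumℕ-≤-* _ (λ p → sumℕ-≤-* _ (λ q → -m≤i≤m⇒∣i∣≤m (lower p q) (upper p q)))
      where
      open ≤-Reasoning
      lower : ∀ p q → - + suc K ≤ laps t p q - laps (flat σ) p q
      lower p q = begin
        - + suc K                                ≡⟨ regroup (+ K) ⟩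
        - + K - 1ℤ + 0ℤ
          ≤⟨ +-mono-≤ (+-monoˡ-≤ -1ℤ -K≤Δ) (neg-mono-≤ (proj₂ (laps-flat-bounds σ p q))) ⟩
        (winding t q - winding t p) - 1ℤ - laps (flat σ) p q
                                                 ≤⟨ +-monoˡ-≤ _ (subst (_ ≤_) (cancel (laps t p q))
                                                      (+-monoˡ-≤ -1ℤ (proj₂ (laps-bounds t p q)))) ⟩
        laps t p q - laps (flat σ) p q           ∎
        where
        regroup : ∀ K → - (1ℤ + K) ≡ - K - 1ℤ + 0ℤ
        regroup = solve-∀
        cancel : ∀ x → x + 1ℤ - 1ℤ ≡ x
        cancel = solve-∀
        -K≤Δ : - + K ≤ winding t q - winding t p
        -K≤Δ = subst (- + K ≤_) (flip (winding t p) (winding t q)) (neg-mono-≤ (narrow q p))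
          where
          flip : ∀ a b → - (a - b) ≡ b - a
          flip = solve-∀
      upper : ∀ p q → laps t p q - laps (flat σ) p q ≤ + suc K
      upper p q = begin
        laps t p q - laps (flat σ) p q
          ≤⟨ +-mono-≤ (proj₁ (laps-bounds t p q)) (neg-mono-≤ (proj₁ (laps-flat-bounds σ p q))) ⟩
        (winding t q - winding t p) + 1ℤ         ≤⟨ +-monoˡ-≤ 1ℤ (narrow p q) ⟩
        + K + 1ℤ                                 ≡⟨ +-comm (+ K) 1ℤ ⟩
        + suc K                                  ∎

    diameter-bound : ∀ (σ τ : Permutation′ n) {k} → FSWalk (Cycle n) Y (σ ⟨$⟩ʳ_) (τ ⟨$⟩ʳ_) k →
                     Σ ℕ λ k′ → FSWalk (Cycle n) Y (σ ⟨$⟩ʳ_) (τ ⟨$⟩ʳ_) k′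
                                × k′ ℕ.≤ n ℕ.* (n ℕ.* suc (n ℕ.* suc n))
    diameter-bound σ τ walk with lift-walk (flat σ) (λ _ → refl) walk
    ... | t , t≗τ , σ∼t with rebalance σ t σ∼t (<-wellFounded _)
    ...   | W , σ∼t′ , narrow with descend (rewind t W) (flat σ) σ∼t′ (<-wellFounded _)
    ...     | k , walk′ , k≤ = k , walk-cong walk′ t≗τ , ℕ.≤-trans k≤ (distance-flat σ (rewind t W) narrow)

open FriendsAndStrangers using (diameter-bound)

open import Data.Nat using (ℕ; _≥_; _^_)
open import Data.Integer using (+_)
open import Data.Rational using (ℚ; _≤_; _<_; _+_; _*_; _/_; 0ℚ; 1ℚ; ∣_∣)
open import Data.Fin.Permutation using (Permutation′; _⟨$⟩ʳ_)
open import Data.Product using (Σ; _×_)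

import Data.Nat as ℕ
import Data.Nat.Properties as ℕ
open import Data.Nat.Tactic.RingSolver using (solve-∀)
import Data.Integer as ℤ
import Data.Integer.Properties as ℤ
import Data.Rational as ℚ
import Data.Rational.Properties as ℚ
open import Data.Nat.Coprimality using (1-coprimeTo) renaming (sym to coprime-sym)
open import Data.Product using (_,_)
open import Relation.Binary.PropositionalEquality using (_≡_; sym; trans; cong; subst)

quartic-bound : ∀ n → n ℕ.* (n ℕ.* ℕ.suc (n ℕ.* ℕ.suc n)) ℕ.≤ 8 ℕ.* n ^ 4
quartic-bound ℕ.zero    = ℕ.z≤n
quartic-bound n@(ℕ.suc _) = begin
  n ℕ.* (n ℕ.* ℕ.suc (n ℕ.* ℕ.suc n))     ≡⟨ expand n ⟩
  n ℕ.* (n ℕ.* (1 ℕ.+ n ℕ.+ n ℕ.* n))     ≤⟨ ℕ.*-monoʳ-≤ n (ℕ.*-monoʳ-≤ n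
                                               (ℕ.+-monoˡ-≤ (n ℕ.* n) (ℕ.+-mono-≤ (ℕ.s≤s ℕ.z≤n)
                                                                                (ℕ.m≤m*n n n)))) ⟩
  n ℕ.* (n ℕ.* (n ℕ.* n ℕ.+ n ℕ.* n ℕ.+ n ℕ.* n)) ≡⟨ collect n ⟩
  3 ℕ.* n ^ 4                              ≤⟨ ℕ.*-monoˡ-≤ (n ^ 4) {3} {8} (ℕ.s≤s (ℕ.s≤s (ℕ.s≤s ℕ.z≤n))) ⟩
  8 ℕ.* n ^ 4                              ∎
  where
  open ℕ.≤-Reasoning
  expand : ∀ n → n ℕ.* (n ℕ.* ℕ.suc (n ℕ.* ℕ.suc n)) ≡ n ℕ.* (n ℕ.* (1 ℕ.+ n ℕ.+ n ℕ.* n))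
  expand = solve-∀
  collect : ∀ n → n ℕ.* (n ℕ.* (n ℕ.* n ℕ.+ n ℕ.* n ℕ.+ n ℕ.* n))
                  ≡ 3 ℕ.* (n ℕ.* (n ℕ.* (n ℕ.* (n ℕ.* 1))))
  collect = solve-∀

+/1≡mkℚ : ∀ k → (+ k) / 1 ≡ ℚ.mkℚ (+ k) 0 (coprime-sym (1-coprimeTo k))
+/1≡mkℚ k = ℚ.↥p/↧p≡p (ℚ.mkℚ (+ k) 0 (coprime-sym (1-coprimeTo k)))

/1-mono-≤ : ∀ {k m} → k ℕ.≤ m → (+ k) / 1 ≤ (+ m) / 1
/1-mono-≤ {k} {m} k≤m rewrite +/1≡mkℚ k | +/1≡mkℚ m = ℚ.*≤* (ℤ.*-monoʳ-≤-nonNeg (+ 1) (ℤ.+≤+ k≤m))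

*[1+0]≡ : ∀ q → q * (1ℚ + 0ℚ) ≡ q
*[1+0]≡ q = trans (cong (q *_) (ℚ.+-identityʳ 1ℚ)) (ℚ.*-identityʳ q)

theorem3p9 : Σ (ℕ → ℚ) λ ε →
    (∀ (δ : ℚ) → 0ℚ < δ → Σ ℕ λ N → ∀ n → n ≥ N → ∣ ε n ∣ ≤ δ)
    × (∀ (n : ℕ) (Y : SimpleGraph n) (σ τ : Permutation′ n) →
         SameComponent (Cycle n) Y σ τ →
         Σ ℕ λ k → FSWalk (Cycle n) Y (σ ⟨$⟩ʳ_) (τ ⟨$⟩ʳ_) k
           × ((+ k) / 1) ≤ ((+ (8 Data.Nat.* (n ^ 4))) / 1) * (1ℚ + ε n))
theorem3p9 = (λ _ → 0ℚ) , (λ δ 0<δ → 0 , λ _ _ → ℚ.<⇒≤ 0<δ) , within-bound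
  where
  within-bound : ∀ n (Y : SimpleGraph n) σ τ → SameComponent (Cycle n) Y σ τ →
                 Σ ℕ λ k → FSWalk (Cycle n) Y (σ ⟨$⟩ʳ_) (τ ⟨$⟩ʳ_) k
                   × ((+ k) / 1) ≤ ((+ (8 Data.Nat.* (n ^ 4))) / 1) * (1ℚ + 0ℚ)
  within-bound n Y σ τ (_ , walk) =
    let k , walk′ , k≤ = diameter-bound Y σ τ walk
    in k , walk′ , subst ((+ k) / 1 ≤_) (sym (*[1+0]≡ ((+ (8 Data.Nat.* (n ^ 4))) / 1)))
                         (/1-mono-≤ (ℕ.≤-trans k≤ (quartic-bound n)))
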